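{- Let $p\geq 5$ be a prime number. If $p\equiv 1 \pmod 3$, then $$\sum_{k=0}^{(p-4)/3}\frac{1}{3k+2}\equiv 0 \pmod p,\qquad \sum_{k=0}^{(p-4)/3}\frac{1}{3k+1}\equiv \frac{1}{2}q_{3} \pmod p,$$ and if $p\equiv 2 \pmod 3$, then $$\sum_{k=0}^{(p-5)/3}\frac{1}{3k+1}\equiv 1 \pmod p,\qquad \sum_{k=0}^{(p-5)/3}\frac{1}{3k+2}\equiv \frac{1}{2}q_{3} \pmod p.$$
   Context: $q_3=(3^{p-1}-1)/p$ is the Fermat quotient. Congruences between rational numbers are understood for rationals whose denominators are coprime to $p$. -}

module Defs where

open import Data.Nat as ℕ using (ℕ; zero; suc; _∸_; _^_; NonZero)
open import Data.Nat.Divisibility using (_∣_)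
open import Data.Integer as ℤ using (+_; ∣_∣)
open import Data.Rational using (ℚ; 0ℚ; _+_; _-_; _/_; ↥_; ↧ₙ_)
open import Data.Product using (_×_)
open import Relation.Nullary using (¬_)

sumTo : ℕ → (ℕ → ℚ) → ℚ
sumTo zero    f = f 0
sumTo (suc n) f = sumTo n f + f (suc n)

-- Congruence of rationals modulo p: both denominators coprime to p
-- (i.e. not divisible by p, p prime) and p divides the numerator of x - y.
_≡_[modℚ_] : ℚ → ℚ → ℕ → Set
x ≡ y [modℚ p ] = ¬ (p ∣ ↧ₙ x) × ¬ (p ∣ ↧ₙ y) × (p ∣ ∣ ↥ (x - y) ∣)

q₃ : (p : ℕ) → .{{NonZero p}} → ℚ
q₃ p = + (3 ^ (p ∸ 1) ∸ 1) / p

module Submission where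

-- We work in the localisation ℤ₍ₚ₎ ⊂ ℚ: m ∣ₚ z means  d·z = m·c  for a natural number d
-- prime to p and an integer c, and  x ≡ y mod[ m ]  means  m ∣ₚ (x - y).
--
-- Vanishing sums come from pairing: 1/a + 1/b = (a + b)/(ab) ≡ 0 when a + b = p, so a
-- progression whose antipodal terms add up to p sums to 0 (antipodal-sum).  The Fermat
-- quotient comes from  3^(p-1)·(p-1)! = Π_{0<j<p} 3j: each multiple 3j is r, r + p or r + 2p
-- for a residue r, and to first order  Π (r + ε) ≡ Π r·(1 + ε Σ 1/r)  (mod p²) for p ∣ ε.
-- Hence  q₃ ≡ X + 2Y (mod p)  with X, Y the reciprocal sums over the residues of the middle
-- and top blocks (fermat-quotient-blocks); X is the vanishing sum, so Y ≡ q₃/2.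
-- The file develops finite sums and products, integers in ℚ, the localisation (ending
-- with the cases p = 3n + 4 and p = 3n + 5), and finally lemma3.

open import Defs
open import Data.Nat using (ℕ; _∸_; _≤_; _+_; _*_; _/_; _%_)
open import Data.Nat.Primality using (Prime; prime⇒nonZero)
open import Data.Integer using (+_)
open import Data.Rational using (ℚ; ½; 0ℚ; 1ℚ) renaming (_/_ to _/ℚ_; _*_ to _*ℚ_)
open import Data.Product using (_×_; _,_; proj₁; proj₂)
open import Relation.Binary.PropositionalEquality using (_≡_)

open import Data.Nat using (zero; suc; _<_; _^_; NonZero; >-nonZero⁻¹; s≤s; z≤n)
import Data.Nat.Properties as ℕ
import Data.Nat.DivMod as ℕDM
open import Data.Nat.Divisibility using (_∣_; ∣-refl; ∣1⇒≡1; ∣m∣n⇒∣m+n; m∣m*n; ∣m⇒∣m*n; ∣n⇒∣m*n; >⇒∤)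
open import Data.Nat.Primality using (euclidsLemma; ¬prime[1])
import Data.Nat.Coprimality as Coprimality
open import Data.Integer as ℤ using (ℤ)
import Data.Integer.Properties as ℤ
open import Data.Rational using (mkℚ; ↥_; ↧_; ↧ₙ_; toℚᵘ)
  renaming (_+_ to _+ℚ_; _-_ to _-ℚ_; -_ to -ℚ_)
import Data.Rational.Properties as ℚ
open import Data.Rational.Unnormalised as ℚᵘ using (mkℚᵘ; *≡*)
import Data.Rational.Unnormalised.Properties as ℚᵘ
open import Data.Empty using (⊥-elim)
open import Data.Maybe using (Maybe; just; nothing)
open import Data.Sum using ([_,_]′)
open import Function using (id; _∘_)
open import Level using (0ℓ)
open import Relation.Binary.Bundles using (Setoid)
open import Relation.Binary.PropositionalEquality using (refl; sym; trans; cong; cong₂; subst; subst₂; module ≡-Reasoning)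
open import Relation.Nullary using (¬_; yes; no)
import Tactic.RingSolver.Core.AlmostCommutativeRing as ACR
open import Tactic.RingSolver using (solve-∀)
import Data.Integer.Tactic.RingSolver as ℤ-Solver
import Data.Nat.Tactic.RingSolver as ℕ-Solver

ℚ-ring : ACR.AlmostCommutativeRing 0ℓ 0ℓ
ℚ-ring = ACR.fromCommutativeRing ℚ.+-*-commutativeRing isZero?
  where
  isZero? : ∀ x → Maybe (0ℚ ≡ x)
  isZero? x with 0ℚ ℚ.≟ x
  ... | yes 0≡x = just 0≡x
  ... | no _    = nothing

sumBelow : ℕ → (ℕ → ℚ) → ℚ
sumBelow zero    f = 0ℚ
sumBelow (suc n) f = sumBelow n f +ℚ f n

prod : ℕ → (ℕ → ℚ) → ℚ
prod zero    f = 1ℚ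
prod (suc n) f = prod n f *ℚ f n

sumTo≡sumBelow : ∀ n f → sumTo n f ≡ sumBelow (suc n) f
sumTo≡sumBelow zero    f = sym (ℚ.+-identityˡ (f 0))
sumTo≡sumBelow (suc n) f = cong (_+ℚ f (suc n)) (sumTo≡sumBelow n f)

sumTo-+ : ∀ n f g → sumTo n (λ k → f k +ℚ g k) ≡ sumTo n f +ℚ sumTo n g
sumTo-+ zero    f g = refl
sumTo-+ (suc n) f g = trans (cong (_+ℚ (f (suc n) +ℚ g (suc n))) (sumTo-+ n f g))
  (interchange (sumTo n f) (sumTo n g) (f (suc n)) (g (suc n)))
  where
  interchange : ∀ a b c d → (a +ℚ b) +ℚ (c +ℚ d) ≡ (a +ℚ c) +ℚ (b +ℚ d)
  interchange = solve-∀ ℚ-ring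

sumTo-peel : ∀ n f → sumTo (suc n) f ≡ f 0 +ℚ sumTo n (λ k → f (suc k))
sumTo-peel zero    f = refl
sumTo-peel (suc n) f = trans (cong (_+ℚ f (suc (suc n))) (sumTo-peel n f))
  (ℚ.+-assoc (f 0) (sumTo n (λ k → f (suc k))) (f (suc (suc n))))

sumTo-reverse : ∀ n f → sumTo n f ≡ sumTo n (λ k → f (n ∸ k))
sumTo-reverse zero    f = refl
sumTo-reverse (suc n) f = begin
  sumTo n f +ℚ f (suc n)                       ≡⟨ cong (_+ℚ f (suc n)) (sumTo-reverse n f) ⟩
  sumTo n (λ k → f (n ∸ k)) +ℚ f (suc n)       ≡⟨ ℚ.+-comm _ (f (suc n)) ⟩
  f (suc n) +ℚ sumTo n (λ k → f (n ∸ k))       ≡⟨ sumTo-peel n (λ k → f (suc n ∸ k)) ⟨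
  sumTo (suc n) (λ k → f (suc n ∸ k))          ∎
  where open ≡-Reasoning

prod-cong : ∀ n {f g} → (∀ i → f i ≡ g i) → prod n f ≡ prod n g
prod-cong zero    f≗g = refl
prod-cong (suc n) f≗g = cong₂ _*ℚ_ (prod-cong n f≗g) (f≗g n)

prod-split : ∀ a b f → prod (a + b) f ≡ prod a f *ℚ prod b (λ i → f (a + i))
prod-split a zero    f = trans (cong (λ n → prod n f) (ℕ.+-identityʳ a)) (sym (ℚ.*-identityʳ (prod a f)))
prod-split a (suc b) f = begin
  prod (a + suc b) f                                     ≡⟨ cong (λ n → prod n f) (ℕ.+-suc a b) ⟩
  prod (a + b) f *ℚ f (a + b)                            ≡⟨ cong (_*ℚ f (a + b)) (prod-split a b f) ⟩
  (prod a f *ℚ prod b (λ i → f (a + i))) *ℚ f (a + b)    ≡⟨ ℚ.*-assoc (prod a f) _ (f (a + b)) ⟩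
  prod a f *ℚ prod (suc b) (λ i → f (a + i))             ∎
  where open ≡-Reasoning

prod-* : ∀ n f g → prod n (λ i → f i *ℚ g i) ≡ prod n f *ℚ prod n g
prod-* zero    f g = refl
prod-* (suc n) f g = trans (cong (_*ℚ (f n *ℚ g n)) (prod-* n f g))
  (interchange (prod n f) (prod n g) (f n) (g n))
  where
  interchange : ∀ a b c d → (a *ℚ b) *ℚ (c *ℚ d) ≡ (a *ℚ c) *ℚ (b *ℚ d)
  interchange = solve-∀ ℚ-ring

prod-by-residue : ∀ m f → prod (3 * m) f ≡
  prod m (λ i → f (3 * i)) *ℚ prod m (λ i → f (1 + 3 * i)) *ℚ prod m (λ i → f (2 + 3 * i))
prod-by-residue zero    f = refl
prod-by-residue (suc m) f = begin
  prod (3 * suc m) f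
    ≡⟨ cong (λ n → prod n f) (ℕ.*-suc 3 m) ⟩
  prod (3 * m) f *ℚ f (3 * m) *ℚ f (1 + 3 * m) *ℚ f (2 + 3 * m)
    ≡⟨ cong (λ t → t *ℚ f (3 * m) *ℚ f (1 + 3 * m) *ℚ f (2 + 3 * m)) (prod-by-residue m f) ⟩
  A *ℚ B *ℚ C *ℚ f (3 * m) *ℚ f (1 + 3 * m) *ℚ f (2 + 3 * m)
    ≡⟨ regroup A B C (f (3 * m)) (f (1 + 3 * m)) (f (2 + 3 * m)) ⟩
  (A *ℚ f (3 * m)) *ℚ (B *ℚ f (1 + 3 * m)) *ℚ (C *ℚ f (2 + 3 * m))
    ∎
  where
  open ≡-Reasoning
  A B C : ℚ
  A = prod m (λ i → f (3 * i))
  B = prod m (λ i → f (1 + 3 * i))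
  C = prod m (λ i → f (2 + 3 * i))
  regroup : ∀ a b c x y z → a *ℚ b *ℚ c *ℚ x *ℚ y *ℚ z ≡ (a *ℚ x) *ℚ (b *ℚ y) *ℚ (c *ℚ z)
  regroup = solve-∀ ℚ-ring

cancel-invertible : ∀ {u v x y} → v *ℚ u ≡ 1ℚ → u *ℚ x ≡ u *ℚ y → x ≡ y
cancel-invertible {u} {v} {x} {y} vu≡1 ux≡uy = begin
  x                ≡⟨ ℚ.*-identityˡ x ⟨
  1ℚ *ℚ x          ≡⟨ cong (_*ℚ x) vu≡1 ⟨
  (v *ℚ u) *ℚ x    ≡⟨ ℚ.*-assoc v u x ⟩
  v *ℚ (u *ℚ x)    ≡⟨ cong (v *ℚ_) ux≡uy ⟩
  v *ℚ (u *ℚ y)    ≡⟨ ℚ.*-assoc v u y ⟨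
  (v *ℚ u) *ℚ y    ≡⟨ cong (_*ℚ y) vu≡1 ⟩
  1ℚ *ℚ y          ≡⟨ ℚ.*-identityˡ y ⟩
  y                ∎
  where open ≡-Reasoning

sum-of-inverses : ∀ A B x y → A *ℚ x ≡ 1ℚ → B *ℚ y ≡ 1ℚ → x +ℚ y ≡ (A +ℚ B) *ℚ (x *ℚ y)
sum-of-inverses A B x y Ax≡1 By≡1 = begin
  x +ℚ y                              ≡⟨ units x y ⟩
  1ℚ *ℚ x +ℚ 1ℚ *ℚ y                  ≡⟨ cong₂ (λ s t → t *ℚ x +ℚ s *ℚ y) Ax≡1 By≡1 ⟨
  (B *ℚ y) *ℚ x +ℚ (A *ℚ x) *ℚ y      ≡⟨ collect A B x y ⟩
  (A +ℚ B) *ℚ (x *ℚ y)                ∎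
  where
  open ≡-Reasoning
  units : ∀ x y → x +ℚ y ≡ 1ℚ *ℚ x +ℚ 1ℚ *ℚ y
  units = solve-∀ ℚ-ring
  collect : ∀ A B x y → (B *ℚ y) *ℚ x +ℚ (A *ℚ x) *ℚ y ≡ (A +ℚ B) *ℚ (x *ℚ y)
  collect = solve-∀ ℚ-ring

ι : ℤ → ℚ
ι k = k /ℚ 1

toℚᵘ-ι : ∀ k → toℚᵘ (ι k) ℚᵘ.≃ mkℚᵘ k 0
toℚᵘ-ι k = ℚ.toℚᵘ-fromℚᵘ (mkℚᵘ k 0)

≃-integer⇒≡ι : ∀ {x : ℚ} (k : ℤ) → toℚᵘ x ℚᵘ.≃ mkℚᵘ k 0 → x ≡ ι k
≃-integer⇒≡ι k x≃k = ℚ.toℚᵘ-injective (ℚᵘ.≃-trans x≃k (ℚᵘ.≃-sym (toℚᵘ-ι k)))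

ι-+ : ∀ a b → ι (a ℤ.+ b) ≡ ι a +ℚ ι b
ι-+ a b = sym (≃-integer⇒≡ι (a ℤ.+ b) (ℚᵘ.≃-trans (ℚ.toℚᵘ-homo-+ (ι a) (ι b))
  (ℚᵘ.≃-trans (ℚᵘ.+-cong (toℚᵘ-ι a) (toℚᵘ-ι b)) (*≡* (identity a b)))))
  where
  identity : ∀ a b → (a ℤ.* + 1 ℤ.+ b ℤ.* + 1) ℤ.* + 1 ≡ (a ℤ.+ b) ℤ.* + 1
  identity = solve-∀ ℤ-Solver.ring

ι-* : ∀ a b → ι (a ℤ.* b) ≡ ι a *ℚ ι b
ι-* a b = sym (≃-integer⇒≡ι (a ℤ.* b) (ℚᵘ.≃-trans (ℚ.toℚᵘ-homo-* (ι a) (ι b))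
  (ℚᵘ.≃-trans (ℚᵘ.*-cong (toℚᵘ-ι a) (toℚᵘ-ι b)) (*≡* refl))))

ι-ℕ-+ : ∀ a b → ι (+ (a + b)) ≡ ι (+ a) +ℚ ι (+ b)
ι-ℕ-+ a b = trans (cong ι (ℤ.pos-+ a b)) (ι-+ (+ a) (+ b))

ι-ℕ-* : ∀ a b → ι (+ (a * b)) ≡ ι (+ a) *ℚ ι (+ b)
ι-ℕ-* a b = trans (cong ι (ℤ.pos-* a b)) (ι-* (+ a) (+ b))

ι-*-/ : ∀ i n .{{_ : NonZero n}} → ι (+ n) *ℚ (i /ℚ n) ≡ ι i
ι-*-/ i n@(suc m) = ≃-integer⇒≡ι i (ℚᵘ.≃-trans (ℚ.toℚᵘ-homo-* (ι (+ n)) (i /ℚ n))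
  (ℚᵘ.≃-trans (ℚᵘ.*-cong (toℚᵘ-ι (+ n)) (ℚ.toℚᵘ-fromℚᵘ (mkℚᵘ i m))) (*≡* (begin
  (+ n ℤ.* i) ℤ.* + 1  ≡⟨ ℤ.*-identityʳ (+ n ℤ.* i) ⟩
  + n ℤ.* i            ≡⟨ ℤ.*-comm (+ n) i ⟩
  i ℤ.* + n            ≡⟨ cong (λ t → i ℤ.* + t) (ℕ.*-identityˡ n) ⟨
  i ℤ.* + (1 * n)      ∎))))
  where open ≡-Reasoning

ι-pred : ∀ n → 1 ≤ n → ι (+ (n ∸ 1)) ≡ ι (+ n) -ℚ 1ℚ
ι-pred n 1≤n = begin
  ι (+ (n ∸ 1))                  ≡⟨ add-and-subtract (ι (+ (n ∸ 1))) ⟩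
  ι (+ (n ∸ 1)) +ℚ 1ℚ -ℚ 1ℚ      ≡⟨ cong (_-ℚ 1ℚ) (ι-ℕ-+ (n ∸ 1) 1) ⟨
  ι (+ (n ∸ 1 + 1)) -ℚ 1ℚ        ≡⟨ cong (λ k → ι (+ k) -ℚ 1ℚ) (ℕ.m∸n+n≡m 1≤n) ⟩
  ι (+ n) -ℚ 1ℚ                  ∎
  where
  open ≡-Reasoning
  add-and-subtract : ∀ x → x ≡ x +ℚ 1ℚ -ℚ 1ℚ
  add-and-subtract = solve-∀ ℚ-ring

recip : ℕ → ℚ
recip k = + 1 /ℚ suc k

ι-equation⇒cross : ∀ d k (z : ℚ) → ι (+ d) *ℚ z ≡ ι k → + d ℤ.* ↥ z ≡ k ℤ.* ↧ z
ι-equation⇒cross d k z@(mkℚ n m _) dz≡k = begin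
  + d ℤ.* n                   ≡⟨ ℤ.*-identityʳ (+ d ℤ.* n) ⟨
  (+ d ℤ.* n) ℤ.* + 1         ≡⟨ ℚᵘ.drop-*≡* cross ⟩
  k ℤ.* + (1 * suc m)         ≡⟨ cong (λ t → k ℤ.* + t) (ℕ.*-identityˡ (suc m)) ⟩
  k ℤ.* + suc m               ∎
  where
  open ≡-Reasoning
  cross : mkℚᵘ (+ d) 0 ℚᵘ.* mkℚᵘ n m ℚᵘ.≃ mkℚᵘ k 0
  cross = ℚᵘ.≃-trans (ℚᵘ.≃-sym (ℚᵘ.*-cong (toℚᵘ-ι (+ d)) ℚᵘ.≃-refl))
    (ℚᵘ.≃-trans (ℚᵘ.≃-sym (ℚ.toℚᵘ-homo-* (ι (+ d)) z)) (ℚᵘ.≃-trans (ℚ.toℚᵘ-cong dz≡k) (toℚᵘ-ι k)))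

prod-scale : ∀ c n f → ι (+ (c ^ n)) *ℚ prod n f ≡ prod n (λ j → ι (+ c) *ℚ f j)
prod-scale c zero    f = ℚ.*-identityˡ 1ℚ
prod-scale c (suc n) f = begin
  ι (+ (c * c ^ n)) *ℚ (prod n f *ℚ f n)            ≡⟨ cong (_*ℚ (prod n f *ℚ f n)) (ι-ℕ-* c (c ^ n)) ⟩
  (ι (+ c) *ℚ ι (+ (c ^ n))) *ℚ (prod n f *ℚ f n)   ≡⟨ regroup (ι (+ c)) (ι (+ (c ^ n))) (prod n f) (f n) ⟩
  (ι (+ (c ^ n)) *ℚ prod n f) *ℚ (ι (+ c) *ℚ f n)   ≡⟨ cong (_*ℚ (ι (+ c) *ℚ f n)) (prod-scale c n f) ⟩
  prod (suc n) (λ j → ι (+ c) *ℚ f j)               ∎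
  where
  open ≡-Reasoning
  regroup : ∀ a b x y → (a *ℚ b) *ℚ (x *ℚ y) ≡ (b *ℚ x) *ℚ (a *ℚ y)
  regroup = solve-∀ ℚ-ring

prod-inverse : ∀ n (h : ℕ → ℕ) → prod n (λ i → ι (+ suc (h i))) *ℚ prod n (recip ∘ h) ≡ 1ℚ
prod-inverse n h = trans (sym (prod-* n _ (recip ∘ h))) (trans (prod-cong n (λ i → ι-*-/ (+ 1) (suc (h i)))) (ones n))
  where
  ones : ∀ n → prod n (λ _ → 1ℚ) ≡ 1ℚ
  ones zero    = refl
  ones (suc n) = trans (ℚ.*-identityʳ _) (ones n)

three-power-blocks : ∀ a b c P (v w : ℕ → ℕ) →
  (∀ i → 3 * suc (a + i) ≡ suc (v i) + P) →
  (∀ i → 3 * suc (a + b + i) ≡ suc (w i) + 2 * P) →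
  ι (+ (3 ^ (a + b + c))) *ℚ prod (a + b + c) (λ j → ι (+ suc j)) ≡
    prod a (λ i → ι (+ (3 * suc i)))
      *ℚ prod b (λ i → ι (+ suc (v i)) +ℚ ι (+ P))
      *ℚ prod c (λ i → ι (+ suc (w i)) +ℚ ι (+ (2 * P)))
three-power-blocks a b c P v w second third = begin
  ι (+ (3 ^ (a + b + c))) *ℚ prod (a + b + c) (λ j → ι (+ suc j))
    ≡⟨ prod-scale 3 (a + b + c) _ ⟩
  prod (a + b + c) (λ j → ι (+ 3) *ℚ ι (+ suc j))
    ≡⟨ prod-cong (a + b + c) (λ j → sym (ι-ℕ-* 3 (suc j))) ⟩
  prod (a + b + c) multiple
    ≡⟨ prod-split (a + b) c multiple ⟩
  prod (a + b) multiple *ℚ prod c (λ i → multiple (a + b + i))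
    ≡⟨ cong (_*ℚ prod c (λ i → multiple (a + b + i))) (prod-split a b multiple) ⟩
  prod a multiple *ℚ prod b (λ i → multiple (a + i)) *ℚ prod c (λ i → multiple (a + b + i))
    ≡⟨ cong₂ (λ s t → prod a multiple *ℚ s *ℚ t)
         (prod-cong b (λ i → trans (cong (ι ∘ +_) (second i)) (ι-ℕ-+ (suc (v i)) P)))
         (prod-cong c (λ i → trans (cong (ι ∘ +_) (third i)) (ι-ℕ-+ (suc (w i)) (2 * P)))) ⟩
  prod a multiple *ℚ prod b (λ i → ι (+ suc (v i)) +ℚ ι (+ P))
    *ℚ prod c (λ i → ι (+ suc (w i)) +ℚ ι (+ (2 * P)))
    ∎
  where
  open ≡-Reasoning
  multiple : ℕ → ℚ
  multiple j = ι (+ (3 * suc j))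

antipodal-residues : ∀ c n k → k ≤ n → (c + 3 * k) + (c + 3 * (n ∸ k)) ≡ 3 * n + (c + c)
antipodal-residues c n k k≤n = trans (regroup c k (n ∸ k)) (cong (λ t → 3 * t + (c + c)) (ℕ.m+[n∸m]≡n k≤n))
  where
  regroup : ∀ c k d → (c + 3 * k) + (c + 3 * d) ≡ 3 * (k + d) + (c + c)
  regroup = solve-∀ ℕ-Solver.ring

module Localisation (p : ℕ) (prime : Prime p) where

  p≢1 : ¬ p ≡ 1
  p≢1 p≡1 = ¬prime[1] (subst Prime p≡1 prime)

  p∤1 : ¬ p ∣ 1
  p∤1 p∣1 = p≢1 (∣1⇒≡1 p∣1)

  p∤-* : ∀ {a b} → ¬ p ∣ a → ¬ p ∣ b → ¬ p ∣ a * b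
  p∤-* p∤a p∤b p∣ab = [ p∤a , p∤b ]′ (euclidsLemma _ _ prime p∣ab)

  record _∣ₚ_ (m : ℕ) (z : ℚ) : Set where
    constructor witness
    field
      den      : ℕ
      p∤den    : ¬ p ∣ den
      quot     : ℤ
      equation : ι (+ den) *ℚ z ≡ ι (+ m ℤ.* quot)

  -- z lies in ℤ₍ₚ₎, i.e. its denominator is prime to p.
  Integral : ℚ → Set
  Integral = 1 ∣ₚ_

  ∣ₚ-integer : ∀ m c → m ∣ₚ ι (+ m ℤ.* c)
  ∣ₚ-integer m c = witness 1 p∤1 c (ℚ.*-identityˡ _)

  ∣ₚ-self : ∀ m → m ∣ₚ ι (+ m)
  ∣ₚ-self m = subst (λ k → m ∣ₚ ι k) (ℤ.*-identityʳ (+ m)) (∣ₚ-integer m (+ 1))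

  ∣ₚ-zero : ∀ m → m ∣ₚ 0ℚ
  ∣ₚ-zero m = subst (λ k → m ∣ₚ ι k) (ℤ.*-zeroʳ (+ m)) (∣ₚ-integer m (+ 0))

  Integral-ι : ∀ k → Integral (ι k)
  Integral-ι k = subst (λ j → Integral (ι j)) (ℤ.*-identityˡ k) (∣ₚ-integer 1 k)

  Integral-recip : ∀ a .{{_ : NonZero a}} → ¬ p ∣ a → Integral (+ 1 /ℚ a)
  Integral-recip a p∤a = witness a p∤a (+ 1) (ι-*-/ (+ 1) a)

  ∣ₚ-+ : ∀ {m z w} → m ∣ₚ z → m ∣ₚ w → m ∣ₚ (z +ℚ w)
  ∣ₚ-+ {m} {z} {w} (witness d p∤d c dz≡mc) (witness e p∤e c' ew≡mc') =
    witness (d * e) (p∤-* p∤d p∤e) (+ e ℤ.* c ℤ.+ + d ℤ.* c') (begin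
      ι (+ (d * e)) *ℚ (z +ℚ w)                               ≡⟨ cong (_*ℚ (z +ℚ w)) (ι-ℕ-* d e) ⟩
      (ι (+ d) *ℚ ι (+ e)) *ℚ (z +ℚ w)                        ≡⟨ distribute (ι (+ d)) (ι (+ e)) z w ⟩
      ι (+ e) *ℚ (ι (+ d) *ℚ z) +ℚ ι (+ d) *ℚ (ι (+ e) *ℚ w)  ≡⟨ cong₂ (λ s t → ι (+ e) *ℚ s +ℚ ι (+ d) *ℚ t) dz≡mc ew≡mc' ⟩
      ι (+ e) *ℚ ι (+ m ℤ.* c) +ℚ ι (+ d) *ℚ ι (+ m ℤ.* c')  ≡⟨ cong₂ _+ℚ_ (ι-* (+ e) (+ m ℤ.* c)) (ι-* (+ d) (+ m ℤ.* c')) ⟨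
      ι (+ e ℤ.* (+ m ℤ.* c)) +ℚ ι (+ d ℤ.* (+ m ℤ.* c'))     ≡⟨ ι-+ (+ e ℤ.* (+ m ℤ.* c)) (+ d ℤ.* (+ m ℤ.* c')) ⟨
      ι (+ e ℤ.* (+ m ℤ.* c) ℤ.+ + d ℤ.* (+ m ℤ.* c'))        ≡⟨ cong ι (factor (+ m) (+ d) (+ e) c c') ⟩
      ι (+ m ℤ.* (+ e ℤ.* c ℤ.+ + d ℤ.* c'))                  ∎)
    where
    open ≡-Reasoning
    distribute : ∀ a b x y → (a *ℚ b) *ℚ (x +ℚ y) ≡ b *ℚ (a *ℚ x) +ℚ a *ℚ (b *ℚ y)
    distribute = solve-∀ ℚ-ring
    factor : ∀ m d e c c' → e ℤ.* (m ℤ.* c) ℤ.+ d ℤ.* (m ℤ.* c') ≡ m ℤ.* (e ℤ.* c ℤ.+ d ℤ.* c')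
    factor = solve-∀ ℤ-Solver.ring

  ∣ₚ-* : ∀ {m n z w} → m ∣ₚ z → n ∣ₚ w → (m * n) ∣ₚ (z *ℚ w)
  ∣ₚ-* {m} {n} {z} {w} (witness d p∤d c dz≡mc) (witness e p∤e c' ew≡nc') =
    witness (d * e) (p∤-* p∤d p∤e) (c ℤ.* c') (begin
      ι (+ (d * e)) *ℚ (z *ℚ w)               ≡⟨ cong (_*ℚ (z *ℚ w)) (ι-ℕ-* d e) ⟩
      (ι (+ d) *ℚ ι (+ e)) *ℚ (z *ℚ w)        ≡⟨ interchange (ι (+ d)) (ι (+ e)) z w ⟩
      (ι (+ d) *ℚ z) *ℚ (ι (+ e) *ℚ w)        ≡⟨ cong₂ _*ℚ_ dz≡mc ew≡nc' ⟩
      ι (+ m ℤ.* c) *ℚ ι (+ n ℤ.* c')         ≡⟨ ι-* (+ m ℤ.* c) (+ n ℤ.* c') ⟨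
      ι ((+ m ℤ.* c) ℤ.* (+ n ℤ.* c'))        ≡⟨ cong ι (interchangeℤ (+ m) c (+ n) c') ⟩
      ι ((+ m ℤ.* + n) ℤ.* (c ℤ.* c'))        ≡⟨ cong (λ k → ι (k ℤ.* (c ℤ.* c'))) (ℤ.pos-* m n) ⟨
      ι (+ (m * n) ℤ.* (c ℤ.* c'))            ∎)
    where
    open ≡-Reasoning
    interchange : ∀ a b x y → (a *ℚ b) *ℚ (x *ℚ y) ≡ (a *ℚ x) *ℚ (b *ℚ y)
    interchange = solve-∀ ℚ-ring
    interchangeℤ : ∀ a b x y → (a ℤ.* b) ℤ.* (x ℤ.* y) ≡ (a ℤ.* x) ℤ.* (b ℤ.* y)
    interchangeℤ = solve-∀ ℤ-Solver.ring

  ∣ₚ-*ˡ : ∀ {m z w} → Integral w → m ∣ₚ z → m ∣ₚ (w *ℚ z)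
  ∣ₚ-*ˡ {m} w∈ℤₚ m∣z = subst (_∣ₚ _) (ℕ.*-identityˡ m) (∣ₚ-* w∈ℤₚ m∣z)

  ∣ₚ-*ʳ : ∀ {m z w} → m ∣ₚ z → Integral w → m ∣ₚ (z *ℚ w)
  ∣ₚ-*ʳ {m} m∣z w∈ℤₚ = subst (_∣ₚ _) (ℕ.*-identityʳ m) (∣ₚ-* m∣z w∈ℤₚ)

  ∣ₚ-neg : ∀ {m z} → m ∣ₚ z → m ∣ₚ (-ℚ z)
  ∣ₚ-neg {m} {z} m∣z = subst (m ∣ₚ_) (minus-one z) (∣ₚ-*ˡ (Integral-ι (ℤ.- + 1)) m∣z)
    where
    minus-one : ∀ z → -ℚ 1ℚ *ℚ z ≡ -ℚ z
    minus-one = solve-∀ ℚ-ring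

  ∣ₚ-cancel : ∀ m {n z} .{{_ : NonZero m}} → (m * n) ∣ₚ (ι (+ m) *ℚ z) → n ∣ₚ z
  ∣ₚ-cancel m {n} {z} (witness d p∤d c eq) = witness d p∤d c
    (cancel-invertible {v = + 1 /ℚ m} (trans (ℚ.*-comm (+ 1 /ℚ m) (ι (+ m))) (ι-*-/ (+ 1) m)) (begin
      ι (+ m) *ℚ (ι (+ d) *ℚ z)        ≡⟨ swap (ι (+ m)) (ι (+ d)) z ⟩
      ι (+ d) *ℚ (ι (+ m) *ℚ z)        ≡⟨ eq ⟩
      ι (+ (m * n) ℤ.* c)              ≡⟨ cong (λ k → ι (k ℤ.* c)) (ℤ.pos-* m n) ⟩
      ι ((+ m ℤ.* + n) ℤ.* c)          ≡⟨ cong ι (ℤ.*-assoc (+ m) (+ n) c) ⟩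
      ι (+ m ℤ.* (+ n ℤ.* c))          ≡⟨ ι-* (+ m) (+ n ℤ.* c) ⟩
      ι (+ m) *ℚ ι (+ n ℤ.* c)         ∎))
    where
    open ≡-Reasoning
    swap : ∀ a b z → a *ℚ (b *ℚ z) ≡ b *ℚ (a *ℚ z)
    swap = solve-∀ ℚ-ring

  ∣ₚ⇒Integral : ∀ {m z} → m ∣ₚ z → Integral z
  ∣ₚ⇒Integral {m} (witness d p∤d c eq) = witness d p∤d (+ m ℤ.* c) (trans eq (cong ι (sym (ℤ.*-identityˡ (+ m ℤ.* c)))))

  witness-cross : ∀ {m z} (w : m ∣ₚ z) → _∣ₚ_.den w * ℤ.∣ ↥ z ∣ ≡ m * ℤ.∣ _∣ₚ_.quot w ∣ * ↧ₙ z
  witness-cross {m} {z} (witness d _ c eq) = begin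
    d * ℤ.∣ ↥ z ∣                      ≡⟨ ℤ.abs-* (+ d) (↥ z) ⟨
    ℤ.∣ + d ℤ.* ↥ z ∣                  ≡⟨ cong ℤ.∣_∣ (ι-equation⇒cross d (+ m ℤ.* c) z eq) ⟩
    ℤ.∣ (+ m ℤ.* c) ℤ.* ↧ z ∣          ≡⟨ ℤ.abs-* (+ m ℤ.* c) (↧ z) ⟩
    ℤ.∣ + m ℤ.* c ∣ * ↧ₙ z             ≡⟨ cong (_* ↧ₙ z) (ℤ.abs-* (+ m) c) ⟩
    m * ℤ.∣ c ∣ * ↧ₙ z                 ∎
    where open ≡-Reasoning

  cancel-den : ∀ {m z x} (w : m ∣ₚ z) → p ∣ _∣ₚ_.den w * x → p ∣ x
  cancel-den w p∣dx = [ ⊥-elim ∘ _∣ₚ_.p∤den w , id ]′ (euclidsLemma _ _ prime p∣dx)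

  Integral⇒p∤↧ : ∀ {z} → Integral z → ¬ p ∣ ↧ₙ z
  Integral⇒p∤↧ {z@(mkℚ n _ coprime)} w p∣↧ =
    p≢1 (Coprimality.recompute coprime (p∣↥ , p∣↧))
    where
    p∣↥ : p ∣ ℤ.∣ n ∣
    p∣↥ = cancel-den w (subst (p ∣_) (sym (witness-cross w)) (∣n⇒∣m*n (1 * ℤ.∣ _∣ₚ_.quot w ∣) p∣↧))

  ∣ₚ⇒p∣↥ : ∀ {z} → p ∣ₚ z → p ∣ ℤ.∣ ↥ z ∣
  ∣ₚ⇒p∣↥ {z} w = cancel-den w (subst (p ∣_) (sym (witness-cross w))
    (∣m⇒∣m*n (↧ₙ z) (m∣m*n ℤ.∣ _∣ₚ_.quot w ∣)))

  record _≡_mod[_] (x y : ℚ) (m : ℕ) : Set where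
    constructor by-difference
    field
      difference : m ∣ₚ (x -ℚ y)

  infix 4 _≡_mod[_]

  mod-reflexive : ∀ {m x y} → x ≡ y → x ≡ y mod[ m ]
  mod-reflexive {m} {x} refl = by-difference (subst (m ∣ₚ_) (sym (ℚ.+-inverseʳ x)) (∣ₚ-zero m))

  mod-refl : ∀ {m} x → x ≡ x mod[ m ]
  mod-refl x = mod-reflexive refl

  mod-sym : ∀ {m x y} → x ≡ y mod[ m ] → y ≡ x mod[ m ]
  mod-sym {m} {x} {y} (by-difference x-y) = by-difference (subst (m ∣ₚ_) (negate x y) (∣ₚ-neg x-y))
    where
    negate : ∀ x y → -ℚ (x -ℚ y) ≡ y -ℚ x
    negate = solve-∀ ℚ-ring

  mod-trans : ∀ {m x y z} → x ≡ y mod[ m ] → y ≡ z mod[ m ] → x ≡ z mod[ m ]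
  mod-trans {m} {x} {y} {z} (by-difference x-y) (by-difference y-z) =
    by-difference (subst (m ∣ₚ_) (telescope x y z) (∣ₚ-+ x-y y-z))
    where
    telescope : ∀ x y z → (x -ℚ y) +ℚ (y -ℚ z) ≡ x -ℚ z
    telescope = solve-∀ ℚ-ring

  mod-setoid : ℕ → Setoid 0ℓ 0ℓ
  mod-setoid m = record
    { Carrier = ℚ
    ; _≈_ = _≡_mod[ m ]
    ; isEquivalence = record { refl = mod-reflexive refl ; sym = mod-sym ; trans = mod-trans }
    }

  mod-+ : ∀ {m x x' y y'} → x ≡ x' mod[ m ] → y ≡ y' mod[ m ] → x +ℚ y ≡ x' +ℚ y' mod[ m ]
  mod-+ {m} {x} {x'} {y} {y'} (by-difference x-x') (by-difference y-y') =
    by-difference (subst (m ∣ₚ_) (rearrange x x' y y') (∣ₚ-+ x-x' y-y'))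
    where
    rearrange : ∀ x x' y y' → (x -ℚ x') +ℚ (y -ℚ y') ≡ (x +ℚ y) -ℚ (x' +ℚ y')
    rearrange = solve-∀ ℚ-ring

  mod-* : ∀ {m x x' y y'} → Integral x' → Integral y →
          x ≡ x' mod[ m ] → y ≡ y' mod[ m ] → x *ℚ y ≡ x' *ℚ y' mod[ m ]
  mod-* {m} {x} {x'} {y} {y'} x'∈ℤₚ y∈ℤₚ (by-difference x-x') (by-difference y-y') =
    by-difference (subst (m ∣ₚ_) (rearrange x x' y y') (∣ₚ-+ (∣ₚ-*ʳ x-x' y∈ℤₚ) (∣ₚ-*ˡ x'∈ℤₚ y-y')))
    where
    rearrange : ∀ x x' y y' → (x -ℚ x') *ℚ y +ℚ x' *ℚ (y -ℚ y') ≡ x *ℚ y -ℚ x' *ℚ y'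
    rearrange = solve-∀ ℚ-ring

  mod-*ˡ : ∀ {m x y} w → Integral w → x ≡ y mod[ m ] → w *ℚ x ≡ w *ℚ y mod[ m ]
  mod-*ˡ {m} {x} {y} w w∈ℤₚ (by-difference x-y) =
    by-difference (subst (m ∣ₚ_) (distribute w x y) (∣ₚ-*ˡ w∈ℤₚ x-y))
    where
    distribute : ∀ w x y → w *ℚ (x -ℚ y) ≡ w *ℚ x -ℚ w *ℚ y
    distribute = solve-∀ ℚ-ring

  mod-cancel-unit : ∀ {m x y} F G → Integral G → G *ℚ F ≡ 1ℚ →
                    F *ℚ x ≡ F *ℚ y mod[ m ] → x ≡ y mod[ m ]
  mod-cancel-unit {m} {x} {y} F G G∈ℤₚ GF≡1 Fx≡Fy =
    subst₂ _≡_mod[ m ] (unit x) (unit y) (mod-*ˡ G G∈ℤₚ Fx≡Fy)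
    where
    unit : ∀ z → G *ℚ (F *ℚ z) ≡ z
    unit z = trans (sym (ℚ.*-assoc G F z)) (trans (cong (_*ℚ z) GF≡1) (ℚ.*-identityˡ z))

  ∣ₚ⇒≡0 : ∀ {m z} → m ∣ₚ z → z ≡ 0ℚ mod[ m ]
  ∣ₚ⇒≡0 {m} {z} m∣z = by-difference (subst (m ∣ₚ_) (minus-zero z) m∣z)
    where
    minus-zero : ∀ z → z ≡ z -ℚ 0ℚ
    minus-zero = solve-∀ ℚ-ring

  mod-cancel : ∀ m {n x y} .{{_ : NonZero m}} → ι (+ m) *ℚ x ≡ ι (+ m) *ℚ y mod[ m * n ] → x ≡ y mod[ n ]
  mod-cancel m {n} {x} {y} (by-difference mx-my) =
    by-difference (∣ₚ-cancel m (subst ((m * n) ∣ₚ_) (factor (ι (+ m)) x y) mx-my))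
    where
    factor : ∀ a x y → a *ℚ x -ℚ a *ℚ y ≡ a *ℚ (x -ℚ y)
    factor = solve-∀ ℚ-ring

  to-modℚ : ∀ {x y} → Integral x → x ≡ y mod[ p ] → x ≡ y [modℚ p ]
  to-modℚ {x} {y} x∈ℤₚ (by-difference x-y) = Integral⇒p∤↧ x∈ℤₚ , Integral⇒p∤↧ y∈ℤₚ , ∣ₚ⇒p∣↥ x-y
    where
    difference : ∀ x y → x +ℚ -ℚ (x -ℚ y) ≡ y
    difference = solve-∀ ℚ-ring
    y∈ℤₚ : Integral y
    y∈ℤₚ = subst Integral (difference x y) (∣ₚ-+ x∈ℤₚ (∣ₚ-neg (∣ₚ⇒Integral x-y)))

  ∣ₚ-sumTo : ∀ {m} n f → (∀ k → k ≤ n → m ∣ₚ f k) → m ∣ₚ sumTo n f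
  ∣ₚ-sumTo zero    f m∣f = m∣f 0 z≤n
  ∣ₚ-sumTo (suc n) f m∣f = ∣ₚ-+ (∣ₚ-sumTo n f (λ k k≤n → m∣f k (ℕ.m≤n⇒m≤1+n k≤n))) (m∣f (suc n) ℕ.≤-refl)

  Integral-sumBelow : ∀ n f → (∀ i → i < n → Integral (f i)) → Integral (sumBelow n f)
  Integral-sumBelow zero    f f∈ℤₚ = ∣ₚ-zero 1
  Integral-sumBelow (suc n) f f∈ℤₚ =
    ∣ₚ-+ (Integral-sumBelow n f (λ i i<n → f∈ℤₚ i (ℕ.m<n⇒m<1+n i<n))) (f∈ℤₚ n ℕ.≤-refl)

  Integral-prod : ∀ n f → (∀ i → i < n → Integral (f i)) → Integral (prod n f)
  Integral-prod zero    f f∈ℤₚ = Integral-ι (+ 1)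
  Integral-prod (suc n) f f∈ℤₚ =
    ∣ₚ-* (Integral-prod n f (λ i i<n → f∈ℤₚ i (ℕ.m<n⇒m<1+n i<n))) (f∈ℤₚ n ℕ.≤-refl)

  -- 1/a + 1/b = (a + b)/(ab) is divisible by p when a + b = p.
  reciprocal-pair : ∀ a b .{{_ : NonZero a}} .{{_ : NonZero b}} → a + b ≡ p →
                    p ∣ₚ (+ 1 /ℚ a +ℚ + 1 /ℚ b)
  reciprocal-pair a b a+b≡p = subst (p ∣ₚ_) (sym sum≡) (∣ₚ-*ʳ (∣ₚ-self p) (∣ₚ-* (Integral-recip a p∤a) (Integral-recip b p∤b)))
    where
    p∤a : ¬ p ∣ a
    p∤a = >⇒∤ (subst (a <_) a+b≡p (ℕ.m<m+n a (>-nonZero⁻¹ b)))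
    p∤b : ¬ p ∣ b
    p∤b = >⇒∤ (subst (b <_) (trans (ℕ.+-comm b a) a+b≡p) (ℕ.m<m+n b (>-nonZero⁻¹ a)))
    sum≡ : + 1 /ℚ a +ℚ + 1 /ℚ b ≡ ι (+ p) *ℚ ((+ 1 /ℚ a) *ℚ (+ 1 /ℚ b))
    sum≡ = trans (sum-of-inverses (ι (+ a)) (ι (+ b)) (+ 1 /ℚ a) (+ 1 /ℚ b) (ι-*-/ (+ 1) a) (ι-*-/ (+ 1) b))
      (cong (_*ℚ ((+ 1 /ℚ a) *ℚ (+ 1 /ℚ b))) (trans (sym (ι-ℕ-+ a b)) (cong (ι ∘ +_) a+b≡p)))

  -- A sum whose terms cancel in antipodal pairs  f k + f (n - k)  is divisible by p
  -- (p odd): twice the sum is the sum of the pairs.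
  antipodal-sum : ¬ p ∣ 2 → ∀ n f → (∀ k → k ≤ n → p ∣ₚ (f k +ℚ f (n ∸ k))) → p ∣ₚ sumTo n f
  antipodal-sum p∤2 n f pairs =
    subst (p ∣ₚ_) halve (∣ₚ-*ˡ (Integral-recip 2 p∤2) (∣ₚ-sumTo n _ pairs))
    where
    S : ℚ
    S = sumTo n f
    half-of-double : ∀ h x → h *ℚ (x +ℚ x) ≡ (h +ℚ h) *ℚ x
    half-of-double = solve-∀ ℚ-ring
    halve : ½ *ℚ sumTo n (λ k → f k +ℚ f (n ∸ k)) ≡ S
    halve = begin
      ½ *ℚ sumTo n (λ k → f k +ℚ f (n ∸ k))     ≡⟨ cong (½ *ℚ_) (sumTo-+ n f (λ k → f (n ∸ k))) ⟩
      ½ *ℚ (S +ℚ sumTo n (λ k → f (n ∸ k)))     ≡⟨ cong (λ t → ½ *ℚ (S +ℚ t)) (sumTo-reverse n f) ⟨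
      ½ *ℚ (S +ℚ S)                             ≡⟨ half-of-double ½ S ⟩
      1ℚ *ℚ S                                   ≡⟨ ℚ.*-identityˡ S ⟩
      S                                         ∎
      where open ≡-Reasoning

  Integral-recips : ∀ n (h : ℕ → ℕ) → (∀ i → i < n → ¬ p ∣ suc (h i)) →
                    Integral (sumBelow n (recip ∘ h))
  Integral-recips n h p∤h = Integral-sumBelow n _ (λ i i<n → Integral-recip (suc (h i)) (p∤h i i<n))

  Integral-naturals : ∀ n (h : ℕ → ℕ) → Integral (prod n (λ i → ι (+ h i)))
  Integral-naturals n h = Integral-prod n _ (λ i _ → Integral-ι (+ h i))

  product-expansion : ∀ n (h : ℕ → ℕ) {ε} → (∀ i → i < n → ¬ p ∣ suc (h i)) → p ∣ₚ ε →
    prod n (λ i → ι (+ suc (h i)) +ℚ ε) ≡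
      prod n (λ i → ι (+ suc (h i))) *ℚ (1ℚ +ℚ ε *ℚ sumBelow n (recip ∘ h)) mod[ p * p ]
  product-expansion zero    h {ε} p∤h p∣ε = mod-reflexive (empty ε)
    where
    empty : ∀ ε → 1ℚ ≡ 1ℚ *ℚ (1ℚ +ℚ ε *ℚ 0ℚ)
    empty = solve-∀ ℚ-ring
  product-expansion (suc n) h {ε} p∤h p∣ε = begin
    prod n (λ i → x i +ℚ ε) *ℚ (x n +ℚ ε)
      ≈⟨ mod-* (∣ₚ-* X∈ℤₚ (∣ₚ-+ (Integral-ι (+ 1)) (∣ₚ-*ˡ ε∈ℤₚ S∈ℤₚ))) (∣ₚ-+ (Integral-ι (+ suc (h n))) ε∈ℤₚ)
               (product-expansion n h (λ i i<n → p∤h i (ℕ.m<n⇒m<1+n i<n)) p∣ε) (mod-refl (x n +ℚ ε)) ⟩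
    X *ℚ (1ℚ +ℚ ε *ℚ S) *ℚ (x n +ℚ ε)
      ≡⟨ expand X S (x n) (recip (h n)) ε ⟩
    Main +ℚ Error +ℚ X *ℚ ε *ℚ (1ℚ -ℚ x n *ℚ recip (h n))
      ≡⟨ cong (λ t → Main +ℚ Error +ℚ X *ℚ ε *ℚ (1ℚ -ℚ t)) (ι-*-/ (+ 1) (suc (h n))) ⟩
    Main +ℚ Error +ℚ X *ℚ ε *ℚ (1ℚ -ℚ 1ℚ)
      ≈⟨ mod-+ (mod-+ (mod-refl Main) (∣ₚ⇒≡0 (∣ₚ-*ʳ (∣ₚ-* p∣ε p∣ε) (∣ₚ-* X∈ℤₚ S∈ℤₚ))))
               (mod-refl (X *ℚ ε *ℚ (1ℚ -ℚ 1ℚ))) ⟩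
    Main +ℚ 0ℚ +ℚ X *ℚ ε *ℚ (1ℚ -ℚ 1ℚ)
      ≡⟨ drop-zeros Main (X *ℚ ε) ⟩
    Main
      ∎
    where
    open import Relation.Binary.Reasoning.Setoid (mod-setoid (p * p))
    x : ℕ → ℚ
    x i = ι (+ suc (h i))
    X S Main Error : ℚ
    X = prod n x
    S = sumBelow n (recip ∘ h)
    Main = X *ℚ x n *ℚ (1ℚ +ℚ ε *ℚ (S +ℚ recip (h n)))
    Error = (ε *ℚ ε) *ℚ (X *ℚ S)
    X∈ℤₚ : Integral X
    X∈ℤₚ = Integral-naturals n (suc ∘ h)
    ε∈ℤₚ : Integral ε
    ε∈ℤₚ = ∣ₚ⇒Integral p∣ε
    S∈ℤₚ : Integral S
    S∈ℤₚ = Integral-recips n h (λ i i<n → p∤h i (ℕ.m<n⇒m<1+n i<n))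
    expand : ∀ X S x g ε → X *ℚ (1ℚ +ℚ ε *ℚ S) *ℚ (x +ℚ ε) ≡
      X *ℚ x *ℚ (1ℚ +ℚ ε *ℚ (S +ℚ g)) +ℚ (ε *ℚ ε) *ℚ (X *ℚ S) +ℚ X *ℚ ε *ℚ (1ℚ -ℚ x *ℚ g)
    expand = solve-∀ ℚ-ring
    drop-zeros : ∀ A B → A +ℚ 0ℚ +ℚ B *ℚ (1ℚ -ℚ 1ℚ) ≡ A
    drop-zeros = solve-∀ ℚ-ring

  instance
    p-nonZero : NonZero p
    p-nonZero = prime⇒nonZero prime

  q₃-from-expansion : ∀ {W} → ι (+ (3 ^ (p ∸ 1))) ≡ 1ℚ +ℚ ι (+ p) *ℚ W mod[ p * p ] → q₃ p ≡ W mod[ p ]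
  q₃-from-expansion {W} power≡ = mod-cancel p (begin
    ι (+ p) *ℚ q₃ p                   ≡⟨ ι-*-/ (+ (3 ^ (p ∸ 1) ∸ 1)) p ⟩
    ι (+ (3 ^ (p ∸ 1) ∸ 1))           ≡⟨ ι-pred (3 ^ (p ∸ 1)) (ℕ.m^n>0 3 (p ∸ 1)) ⟩
    ι (+ (3 ^ (p ∸ 1))) -ℚ 1ℚ         ≈⟨ mod-+ power≡ (mod-refl (-ℚ 1ℚ)) ⟩
    1ℚ +ℚ ι (+ p) *ℚ W -ℚ 1ℚ          ≡⟨ cancel-one (ι (+ p) *ℚ W) ⟩
    ι (+ p) *ℚ W                      ∎)
    where
    open import Relation.Binary.Reasoning.Setoid (mod-setoid (p * p))
    cancel-one : ∀ x → 1ℚ +ℚ x -ℚ 1ℚ ≡ x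
    cancel-one = solve-∀ ℚ-ring

  p∤-shifted-multiple : ¬ p ∣ 3 → ∀ j x y → suc j < p → 3 * suc j ≡ x + y → p ∣ y → ¬ p ∣ x
  p∤-shifted-multiple p∤3 j x y j<p 3j≡x+y p∣y p∣x =
    [ p∤3 , >⇒∤ j<p ]′ (euclidsLemma 3 (suc j) prime (subst (p ∣_) (sym 3j≡x+y) (∣m∣n⇒∣m+n p∣x p∣y)))

  product-of-near-units : ∀ {ε δ X Y} → p ∣ₚ ε → p ∣ₚ δ → Integral X → Integral Y →
    (1ℚ +ℚ ε *ℚ X) *ℚ (1ℚ +ℚ δ *ℚ Y) ≡ 1ℚ +ℚ ε *ℚ X +ℚ δ *ℚ Y mod[ p * p ]
  product-of-near-units {ε} {δ} {X} {Y} p∣ε p∣δ X∈ℤₚ Y∈ℤₚ = begin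
    (1ℚ +ℚ ε *ℚ X) *ℚ (1ℚ +ℚ δ *ℚ Y)           ≡⟨ expand ε δ X Y ⟩
    1ℚ +ℚ ε *ℚ X +ℚ δ *ℚ Y +ℚ (ε *ℚ δ) *ℚ (X *ℚ Y)
      ≈⟨ mod-+ (mod-refl (1ℚ +ℚ ε *ℚ X +ℚ δ *ℚ Y)) (∣ₚ⇒≡0 (∣ₚ-*ʳ (∣ₚ-* p∣ε p∣δ) (∣ₚ-* X∈ℤₚ Y∈ℤₚ))) ⟩
    1ℚ +ℚ ε *ℚ X +ℚ δ *ℚ Y +ℚ 0ℚ               ≡⟨ ℚ.+-identityʳ _ ⟩
    1ℚ +ℚ ε *ℚ X +ℚ δ *ℚ Y                     ∎
    where
    open import Relation.Binary.Reasoning.Setoid (mod-setoid (p * p))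
    expand : ∀ ε δ X Y → (1ℚ +ℚ ε *ℚ X) *ℚ (1ℚ +ℚ δ *ℚ Y) ≡ 1ℚ +ℚ ε *ℚ X +ℚ δ *ℚ Y +ℚ (ε *ℚ δ) *ℚ (X *ℚ Y)
    expand = solve-∀ ℚ-ring

  suc-below-p : ∀ {j} → j < p ∸ 1 → suc j < p
  suc-below-p j<p-1 = ℕ.<-≤-trans (s≤s j<p-1) (ℕ.≤-reflexive (ℕ.suc-pred p))

  block-residues-coprime : ¬ p ∣ 3 → ∀ a b c (v w : ℕ → ℕ) → a + b + c ≡ p ∸ 1 →
    (∀ i → 3 * suc (a + i) ≡ suc (v i) + p) →
    (∀ i → 3 * suc (a + b + i) ≡ suc (w i) + 2 * p) →
    (∀ i → i < b → ¬ p ∣ suc (v i)) × (∀ i → i < c → ¬ p ∣ suc (w i))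
  block-residues-coprime p∤3 a b c v w N≡ second third =
    (λ i i<b → p∤-shifted-multiple p∤3 (a + i) (suc (v i)) p
       (suc-below-p (subst (a + i <_) N≡ (ℕ.<-≤-trans (ℕ.+-monoʳ-< a i<b) (ℕ.m≤m+n (a + b) c))))
       (second i) ∣-refl) ,
    (λ i i<c → p∤-shifted-multiple p∤3 (a + b + i) (suc (w i)) (2 * p)
       (suc-below-p (subst (a + b + i <_) N≡ (ℕ.+-monoʳ-< (a + b) i<c)))
       (third i) (∣n⇒∣m*n 2 ∣-refl))

  Integral-near-unit : ∀ {ε Z} → p ∣ₚ ε → Integral Z → Integral (1ℚ +ℚ ε *ℚ Z)
  Integral-near-unit p∣ε Z∈ℤₚ = ∣ₚ-+ (Integral-ι (+ 1)) (∣ₚ-* (∣ₚ⇒Integral p∣ε) Z∈ℤₚ)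

  fermat-quotient-blocks : ¬ p ∣ 3 → ∀ a b c (v w : ℕ → ℕ) → a + b + c ≡ p ∸ 1 →
    (∀ i → 3 * suc (a + i) ≡ suc (v i) + p) →
    (∀ i → 3 * suc (a + b + i) ≡ suc (w i) + 2 * p) →
    prod (p ∸ 1) (λ j → ι (+ suc j)) ≡
      prod a (λ i → ι (+ (3 * suc i))) *ℚ prod b (λ i → ι (+ suc (v i))) *ℚ prod c (λ i → ι (+ suc (w i))) →
    q₃ p ≡ sumBelow b (recip ∘ v) +ℚ ι (+ 2) *ℚ sumBelow c (recip ∘ w) mod[ p ]
  fermat-quotient-blocks p∤3 a b c v w N≡ second third factorial≡ =
    q₃-from-expansion (mod-cancel-unit F G G∈ℤₚ (trans (ℚ.*-comm G F) (prod-inverse N id)) (begin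
      F *ℚ ι (+ (3 ^ N))
        ≡⟨ ℚ.*-comm F (ι (+ (3 ^ N))) ⟩
      ι (+ (3 ^ N)) *ℚ F
        ≡⟨ subst (λ n → ι (+ (3 ^ n)) *ℚ prod n (λ j → ι (+ suc j)) ≡ U *ℚ V' *ℚ W') N≡
             (three-power-blocks a b c p v w second third) ⟩
      U *ℚ V' *ℚ W'
        ≈⟨ mod-* (∣ₚ-* U∈ℤₚ (∣ₚ-* V∈ℤₚ (Integral-near-unit p∣p X∈ℤₚ))) W'∈ℤₚ
             (mod-*ˡ U U∈ℤₚ (product-expansion b v p∤v p∣p)) (product-expansion c w p∤w p∣2p) ⟩
      U *ℚ (V *ℚ (1ℚ +ℚ ι (+ p) *ℚ X)) *ℚ (W *ℚ (1ℚ +ℚ ι (+ (2 * p)) *ℚ Y))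
        ≡⟨ regroup U V W (1ℚ +ℚ ι (+ p) *ℚ X) (1ℚ +ℚ ι (+ (2 * p)) *ℚ Y) ⟩
      (U *ℚ V *ℚ W) *ℚ ((1ℚ +ℚ ι (+ p) *ℚ X) *ℚ (1ℚ +ℚ ι (+ (2 * p)) *ℚ Y))
        ≡⟨ cong (_*ℚ ((1ℚ +ℚ ι (+ p) *ℚ X) *ℚ (1ℚ +ℚ ι (+ (2 * p)) *ℚ Y))) factorial≡ ⟨
      F *ℚ ((1ℚ +ℚ ι (+ p) *ℚ X) *ℚ (1ℚ +ℚ ι (+ (2 * p)) *ℚ Y))
        ≈⟨ mod-*ˡ F F∈ℤₚ (product-of-near-units p∣p p∣2p X∈ℤₚ Y∈ℤₚ) ⟩
      F *ℚ (1ℚ +ℚ ι (+ p) *ℚ X +ℚ ι (+ (2 * p)) *ℚ Y)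
        ≡⟨ cong (λ t → F *ℚ (1ℚ +ℚ ι (+ p) *ℚ X +ℚ t *ℚ Y)) (ι-ℕ-* 2 p) ⟩
      F *ℚ (1ℚ +ℚ ι (+ p) *ℚ X +ℚ (ι (+ 2) *ℚ ι (+ p)) *ℚ Y)
        ≡⟨ collect F (ι (+ p)) (ι (+ 2)) X Y ⟩
      F *ℚ (1ℚ +ℚ ι (+ p) *ℚ (X +ℚ ι (+ 2) *ℚ Y))
        ∎))
    where
    open import Relation.Binary.Reasoning.Setoid (mod-setoid (p * p))
    N : ℕ
    N = p ∸ 1
    F G U V W V' W' X Y : ℚ
    F = prod N (λ j → ι (+ suc j))
    G = prod N recip
    U = prod a (λ i → ι (+ (3 * suc i)))
    V = prod b (λ i → ι (+ suc (v i)))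
    W = prod c (λ i → ι (+ suc (w i)))
    V' = prod b (λ i → ι (+ suc (v i)) +ℚ ι (+ p))
    W' = prod c (λ i → ι (+ suc (w i)) +ℚ ι (+ (2 * p)))
    X = sumBelow b (recip ∘ v)
    Y = sumBelow c (recip ∘ w)
    residues-coprime : (∀ i → i < b → ¬ p ∣ suc (v i)) × (∀ i → i < c → ¬ p ∣ suc (w i))
    residues-coprime = block-residues-coprime p∤3 a b c v w N≡ second third
    p∤v : ∀ i → i < b → ¬ p ∣ suc (v i)
    p∤v = proj₁ residues-coprime
    p∤w : ∀ i → i < c → ¬ p ∣ suc (w i)
    p∤w = proj₂ residues-coprime
    p∣p : p ∣ₚ ι (+ p)
    p∣p = ∣ₚ-self p
    p∣2p : p ∣ₚ ι (+ (2 * p))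
    p∣2p = subst (p ∣ₚ_) (sym (ι-ℕ-* 2 p)) (∣ₚ-*ˡ (Integral-ι (+ 2)) p∣p)
    F∈ℤₚ : Integral F
    F∈ℤₚ = Integral-naturals N suc
    G∈ℤₚ : Integral G
    G∈ℤₚ = Integral-prod N recip (λ j j<N → Integral-recip (suc j) (>⇒∤ (suc-below-p j<N)))
    U∈ℤₚ : Integral U
    U∈ℤₚ = Integral-naturals a (λ i → 3 * suc i)
    V∈ℤₚ : Integral V
    V∈ℤₚ = Integral-naturals b (suc ∘ v)
    W'∈ℤₚ : Integral W'
    W'∈ℤₚ = Integral-prod c _ (λ i _ → ∣ₚ-+ (Integral-ι (+ suc (w i))) (∣ₚ⇒Integral p∣2p))
    X∈ℤₚ : Integral X
    X∈ℤₚ = Integral-recips b v p∤v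
    Y∈ℤₚ : Integral Y
    Y∈ℤₚ = Integral-recips c w p∤w
    regroup : ∀ U V W A B → U *ℚ (V *ℚ A) *ℚ (W *ℚ B) ≡ (U *ℚ V *ℚ W) *ℚ (A *ℚ B)
    regroup = solve-∀ ℚ-ring
    collect : ∀ F P T X Y → F *ℚ (1ℚ +ℚ P *ℚ X +ℚ (T *ℚ P) *ℚ Y) ≡ F *ℚ (1ℚ +ℚ P *ℚ (X +ℚ T *ℚ Y))
    collect = solve-∀ ℚ-ring

  half-of-quotient : ¬ p ∣ 2 → ∀ {q X Y} → X ≡ 0ℚ mod[ p ] → q ≡ X +ℚ ι (+ 2) *ℚ Y mod[ p ] → Y ≡ ½ *ℚ q mod[ p ]
  half-of-quotient p∤2 {q} {X} {Y} X≡0 q≡X+2Y = begin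
    Y                                   ≡⟨ isolate ½ (ι (+ 2)) X Y refl ⟨
    ½ *ℚ (X +ℚ ι (+ 2) *ℚ Y) +ℚ (-ℚ ½) *ℚ X
      ≈⟨ mod-+ (mod-*ˡ ½ ½∈ℤₚ (mod-sym q≡X+2Y)) (mod-*ˡ (-ℚ ½) (∣ₚ-neg ½∈ℤₚ) X≡0) ⟩
    ½ *ℚ q +ℚ (-ℚ ½) *ℚ 0ℚ              ≡⟨ drop-zero ½ q ⟩
    ½ *ℚ q                              ∎
    where
    open import Relation.Binary.Reasoning.Setoid (mod-setoid p)
    ½∈ℤₚ : Integral ½
    ½∈ℤₚ = Integral-recip 2 p∤2
    regroup : ∀ h t X Y → h *ℚ (X +ℚ t *ℚ Y) +ℚ (-ℚ h) *ℚ X ≡ (h *ℚ t) *ℚ Y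
    regroup = solve-∀ ℚ-ring
    isolate : ∀ h t X Y → h *ℚ t ≡ 1ℚ → h *ℚ (X +ℚ t *ℚ Y) +ℚ (-ℚ h) *ℚ X ≡ Y
    isolate h t X Y ht≡1 = trans (regroup h t X Y) (trans (cong (_*ℚ Y) ht≡1) (ℚ.*-identityˡ Y))
    drop-zero : ∀ h q → h *ℚ q +ℚ (-ℚ h) *ℚ 0ℚ ≡ h *ℚ q
    drop-zero = solve-∀ ℚ-ring

  Integral-progression : ∀ c n → suc (c + 3 * n) < p → Integral (sumTo n (λ k → recip (c + 3 * k)))
  Integral-progression c n last<p = ∣ₚ-sumTo n _ (λ k k≤n →
    Integral-recip (suc (c + 3 * k)) (>⇒∤ (ℕ.≤-<-trans (s≤s (ℕ.+-monoʳ-≤ c (ℕ.*-monoʳ-≤ 3 k≤n))) last<p)))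

  below-p : ∀ x d → suc x + d ≡ p → x < p
  below-p x d x+1+d≡p = subst (suc x ≤_) x+1+d≡p (ℕ.m≤m+n (suc x) d)

  p∤2∧p∤3 : ∀ d → 4 + d ≡ p → ¬ p ∣ 2 × ¬ p ∣ 3
  p∤2∧p∤3 d 4+d≡p = >⇒∤ (below-p 2 (suc d) (trans (ℕ.+-suc 3 d) 4+d≡p)) , >⇒∤ (below-p 3 d 4+d≡p)

  -- For p = 3n + 4 the reciprocals of 2, 5, …, 3n + 2 cancel in antipodal pairs.
  sum-two-mod-three-vanishes : ∀ n → p ≡ 3 * n + 4 → p ∣ₚ sumTo n (λ k → + 1 /ℚ (2 + 3 * k))
  sum-two-mod-three-vanishes n p≡ =
    antipodal-sum (proj₁ (p∤2∧p∤3 (3 * n) (trans (ℕ.+-comm 4 (3 * n)) (sym p≡)))) n _ (λ k k≤n →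
      reciprocal-pair (2 + 3 * k) (2 + 3 * (n ∸ k)) (trans (antipodal-residues 2 n k k≤n) (sym p≡)))

  -- For p = 3n + 4 = 3m + 1 the multiples 3, …, 3m lie below p, 3(m+1+i) = (3i + 2) + p and
  -- 3(2m+1+i) = (3i + 1) + 2p for i < m.
  q₃-one-mod-three : ∀ n → p ≡ 3 * n + 4 →
    q₃ p ≡ sumBelow (suc n) (λ i → recip (1 + 3 * i)) +ℚ ι (+ 2) *ℚ sumBelow (suc n) (λ i → recip (3 * i)) mod[ p ]
  q₃-one-mod-three n p≡ = fermat-quotient-blocks
    (proj₂ (p∤2∧p∤3 (3 * n) (trans (ℕ.+-comm 4 (3 * n)) (sym p≡)))) m m m (λ i → 1 + 3 * i) (λ i → 3 * i)
    (trans (blocks n) (sym p∸1≡))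
    (λ i → trans (middle n i) (cong (λ t → suc (1 + 3 * i) + t) (sym p≡)))
    (λ i → trans (top n i) (cong (λ t → suc (3 * i) + 2 * t) (sym p≡)))
    (begin
      prod (p ∸ 1) (λ j → ι (+ suc j))             ≡⟨ cong (λ N → prod N (λ j → ι (+ suc j))) p∸1≡ ⟩
      prod (3 * m) (λ j → ι (+ suc j))             ≡⟨ prod-by-residue m (λ j → ι (+ suc j)) ⟩
      W *ℚ V *ℚ prod m (λ i → ι (+ suc (2 + 3 * i)))
        ≡⟨ cong (W *ℚ V *ℚ_) (prod-cong m (λ i → cong (ι ∘ +_) (ℕ.*-suc 3 i))) ⟨
      W *ℚ V *ℚ U                                  ≡⟨ reverse W V U ⟩
      U *ℚ V *ℚ W                                  ∎)
    where
    open ≡-Reasoning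
    m : ℕ
    m = suc n
    U V W : ℚ
    U = prod m (λ i → ι (+ (3 * suc i)))
    V = prod m (λ i → ι (+ suc (1 + 3 * i)))
    W = prod m (λ i → ι (+ suc (3 * i)))
    p∸1≡ : p ∸ 1 ≡ 3 * m
    p∸1≡ = cong (_∸ 1) (trans p≡ (pred-form n))
      where
      pred-form : ∀ n → 3 * n + 4 ≡ suc (3 * suc n)
      pred-form = solve-∀ ℕ-Solver.ring
    blocks : ∀ n → suc n + suc n + suc n ≡ 3 * suc n
    blocks = solve-∀ ℕ-Solver.ring
    middle : ∀ n i → 3 * suc (suc n + i) ≡ suc (1 + 3 * i) + (3 * n + 4)
    middle = solve-∀ ℕ-Solver.ring
    top : ∀ n i → 3 * suc (suc n + suc n + i) ≡ suc (3 * i) + 2 * (3 * n + 4)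
    top = solve-∀ ℕ-Solver.ring
    reverse : ∀ a b c → a *ℚ b *ℚ c ≡ c *ℚ b *ℚ a
    reverse = solve-∀ ℚ-ring

  case-one-mod-three : ∀ n → p ≡ 3 * n + 4 →
    (sumTo n (λ k → + 1 /ℚ (2 + 3 * k)) ≡ 0ℚ [modℚ p ]) ×
    (sumTo n (λ k → + 1 /ℚ (1 + 3 * k)) ≡ ½ *ℚ q₃ p [modℚ p ])
  case-one-mod-three n p≡ =
    to-modℚ (Integral-progression 1 n (below-p _ 1 (trans (last-two n) (sym p≡)))) (∣ₚ⇒≡0 vanishes) ,
    to-modℚ (Integral-progression 0 n (below-p _ 2 (trans (last-one n) (sym p≡))))
      (subst (_≡ ½ *ℚ q₃ p mod[ p ]) (sym (sumTo≡sumBelow n _))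
        (half-of-quotient (proj₁ (p∤2∧p∤3 (3 * n) (trans (ℕ.+-comm 4 (3 * n)) (sym p≡))))
          (subst (_≡ 0ℚ mod[ p ]) (sumTo≡sumBelow n _) (∣ₚ⇒≡0 vanishes)) (q₃-one-mod-three n p≡)))
    where
    vanishes : p ∣ₚ sumTo n (λ k → + 1 /ℚ (2 + 3 * k))
    vanishes = sum-two-mod-three-vanishes n p≡
    last-two : ∀ n → suc (suc (1 + 3 * n)) + 1 ≡ 3 * n + 4
    last-two = solve-∀ ℕ-Solver.ring
    last-one : ∀ n → suc (suc (0 + 3 * n)) + 2 ≡ 3 * n + 4
    last-one = solve-∀ ℕ-Solver.ring

  -- For p = 3n + 5 the reciprocals of 1, 4, …, 3n + 4 cancel in antipodal pairs.
  sum-one-mod-three-vanishes : ∀ n → p ≡ 3 * n + 5 → p ∣ₚ sumTo (suc n) (λ k → + 1 /ℚ (1 + 3 * k))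
  sum-one-mod-three-vanishes n p≡ =
    antipodal-sum (proj₁ (p∤2∧p∤3 (3 * n + 1) (trans (four-plus n) (sym p≡)))) (suc n) _ (λ k k≤n →
      reciprocal-pair (1 + 3 * k) (1 + 3 * (suc n ∸ k))
        (trans (antipodal-residues 1 (suc n) k k≤n) (trans (ends n) (sym p≡))))
    where
    four-plus : ∀ n → 4 + (3 * n + 1) ≡ 3 * n + 5
    four-plus = solve-∀ ℕ-Solver.ring
    ends : ∀ n → 3 * suc n + (1 + 1) ≡ 3 * n + 5
    ends = solve-∀ ℕ-Solver.ring

  -- For p = 3n + 5 = 3m + 2 the multiples 3, …, 3m lie below p, 3(m+1+i) = (3i + 1) + p for
  -- i ≤ m and 3(2m+2+i) = (3i + 2) + 2p for i < m.
  q₃-two-mod-three : ∀ n → p ≡ 3 * n + 5 →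
    q₃ p ≡ sumBelow (suc (suc n)) (λ i → recip (3 * i)) +ℚ ι (+ 2) *ℚ sumBelow (suc n) (λ i → recip (1 + 3 * i)) mod[ p ]
  q₃-two-mod-three n p≡ = fermat-quotient-blocks
    (proj₂ (p∤2∧p∤3 (3 * n + 1) (trans (four-plus n) (sym p≡)))) m (suc m) m (λ i → 3 * i) (λ i → 1 + 3 * i)
    (trans (blocks n) (sym p∸1≡))
    (λ i → trans (middle n i) (cong (λ t → suc (3 * i) + t) (sym p≡)))
    (λ i → trans (top n i) (cong (λ t → suc (1 + 3 * i) + 2 * t) (sym p≡)))
    (begin
      prod (p ∸ 1) (λ j → ι (+ suc j))             ≡⟨ cong (λ N → prod N (λ j → ι (+ suc j))) p∸1≡ ⟩
      prod (3 * m) (λ j → ι (+ suc j)) *ℚ last     ≡⟨ cong (_*ℚ last) (prod-by-residue m (λ j → ι (+ suc j))) ⟩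
      V₀ *ℚ W *ℚ prod m (λ i → ι (+ suc (2 + 3 * i))) *ℚ last
        ≡⟨ cong (λ t → V₀ *ℚ W *ℚ t *ℚ last) (prod-cong m (λ i → cong (ι ∘ +_) (ℕ.*-suc 3 i))) ⟨
      V₀ *ℚ W *ℚ U *ℚ last                         ≡⟨ rearrange V₀ W U last ⟩
      U *ℚ (V₀ *ℚ last) *ℚ W                       ∎)
    where
    open ≡-Reasoning
    m : ℕ
    m = suc n
    U V₀ W last : ℚ
    U = prod m (λ i → ι (+ (3 * suc i)))
    V₀ = prod m (λ i → ι (+ suc (3 * i)))
    W = prod m (λ i → ι (+ suc (1 + 3 * i)))
    last = ι (+ suc (3 * m))
    p∸1≡ : p ∸ 1 ≡ suc (3 * m)
    p∸1≡ = cong (_∸ 1) (trans p≡ (pred-form n))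
      where
      pred-form : ∀ n → 3 * n + 5 ≡ suc (suc (3 * suc n))
      pred-form = solve-∀ ℕ-Solver.ring
    four-plus : ∀ n → 4 + (3 * n + 1) ≡ 3 * n + 5
    four-plus = solve-∀ ℕ-Solver.ring
    blocks : ∀ n → suc n + suc (suc n) + suc n ≡ suc (3 * suc n)
    blocks = solve-∀ ℕ-Solver.ring
    middle : ∀ n i → 3 * suc (suc n + i) ≡ suc (3 * i) + (3 * n + 5)
    middle = solve-∀ ℕ-Solver.ring
    top : ∀ n i → 3 * suc (suc n + suc (suc n) + i) ≡ suc (1 + 3 * i) + 2 * (3 * n + 5)
    top = solve-∀ ℕ-Solver.ring
    rearrange : ∀ a b c d → a *ℚ b *ℚ c *ℚ d ≡ c *ℚ (a *ℚ d) *ℚ b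
    rearrange = solve-∀ ℚ-ring

  -- The theorem for p = 3n + 5; the first sum is the vanishing one minus its extreme terms
  -- 1 and 1/(p - 1), which cancel each other.
  case-two-mod-three : ∀ n → p ≡ 3 * n + 5 →
    (sumTo n (λ k → + 1 /ℚ (1 + 3 * k)) ≡ 1ℚ [modℚ p ]) ×
    (sumTo n (λ k → + 1 /ℚ (2 + 3 * k)) ≡ ½ *ℚ q₃ p [modℚ p ])
  case-two-mod-three n p≡ =
    to-modℚ {y = 1ℚ} (Integral-progression 0 n (below-p _ 3 (trans (last-one n) (sym p≡))))
      (by-difference (subst (p ∣ₚ_) (drop-last (sumTo n g) (g (suc n))) (∣ₚ-+ vanishes (∣ₚ-neg ends≡0)))) ,
    to-modℚ (Integral-progression 1 n (below-p _ 2 (trans (last-two n) (sym p≡))))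
      (subst (_≡ ½ *ℚ q₃ p mod[ p ]) (sym (sumTo≡sumBelow n _))
        (half-of-quotient (proj₁ (p∤2∧p∤3 (3 * n + 1) (trans (four-plus n) (sym p≡))))
          (subst (_≡ 0ℚ mod[ p ]) (sumTo≡sumBelow (suc n) g) (∣ₚ⇒≡0 vanishes)) (q₃-two-mod-three n p≡)))
    where
    g : ℕ → ℚ
    g k = + 1 /ℚ (1 + 3 * k)
    last-one : ∀ n → suc (suc (0 + 3 * n)) + 3 ≡ 3 * n + 5
    last-one = solve-∀ ℕ-Solver.ring
    last-two : ∀ n → suc (suc (1 + 3 * n)) + 2 ≡ 3 * n + 5
    last-two = solve-∀ ℕ-Solver.ring
    four-plus : ∀ n → 4 + (3 * n + 1) ≡ 3 * n + 5
    four-plus = solve-∀ ℕ-Solver.ring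
    extremes : ∀ n → 1 + (1 + 3 * suc n) ≡ 3 * n + 5
    extremes = solve-∀ ℕ-Solver.ring
    vanishes : p ∣ₚ sumTo (suc n) g
    vanishes = sum-one-mod-three-vanishes n p≡
    ends≡0 : p ∣ₚ (1ℚ +ℚ g (suc n))
    ends≡0 = reciprocal-pair 1 (1 + 3 * suc n) (trans (extremes n) (sym p≡))
    drop-last : ∀ S x → S +ℚ x +ℚ -ℚ (1ℚ +ℚ x) ≡ S -ℚ 1ℚ
    drop-last = solve-∀ ℚ-ring

residue-decomposition : ∀ m r → m % 3 ≡ r → 3 + r ≤ m → m ≡ 3 * ((m ∸ (3 + r)) / 3) + (3 + r)
residue-decomposition m r m%3≡r 3+r≤m with m / 3 | ℕDM.m≡m%n+[m/n]*n m 3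
... | zero  | m≡ = ⊥-elim (ℕ.<-irrefl refl (ℕ.≤-trans (s≤s (ℕ.m≤n+m r 2))
                  (subst (3 + r ≤_) (trans m≡ (trans (cong (_+ 0) m%3≡r) (ℕ.+-identityʳ r))) 3+r≤m)))
... | suc q | m≡ = begin
  m                                                ≡⟨ m≡q*3+3+r ⟩
  q * 3 + (3 + r)                                  ≡⟨ cong (_+ (3 + r)) (ℕ.*-comm q 3) ⟩
  3 * q + (3 + r)                                  ≡⟨ cong (λ t → 3 * t + (3 + r)) (ℕDM.m*n/n≡m q 3) ⟨
  3 * (q * 3 / 3) + (3 + r)                        ≡⟨ cong (λ t → 3 * (t / 3) + (3 + r)) (ℕ.m+n∸n≡m (q * 3) (3 + r)) ⟨
  3 * ((q * 3 + (3 + r) ∸ (3 + r)) / 3) + (3 + r)  ≡⟨ cong (λ t → 3 * ((t ∸ (3 + r)) / 3) + (3 + r)) m≡q*3+3+r ⟨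
  3 * ((m ∸ (3 + r)) / 3) + (3 + r)                ∎
  where
  open ≡-Reasoning
  regroup : ∀ r q → r + suc q * 3 ≡ q * 3 + (3 + r)
  regroup = solve-∀ ℕ-Solver.ring
  m≡q*3+3+r : m ≡ q * 3 + (3 + r)
  m≡q*3+3+r = trans m≡ (trans (cong (_+ suc q * 3) m%3≡r) (regroup r q))

lemma3 : (p : ℕ) → (pr : Prime p) → 5 ≤ p →
    (p % 3 ≡ 1 →
      (sumTo ((p ∸ 4) / 3) (λ k → + 1 /ℚ (2 + 3 * k)) ≡ 0ℚ [modℚ p ])
      × (sumTo ((p ∸ 4) / 3) (λ k → + 1 /ℚ (1 + 3 * k)) ≡ ½ *ℚ q₃ p {{prime⇒nonZero pr}} [modℚ p ]))
    × (p % 3 ≡ 2 →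
      (sumTo ((p ∸ 5) / 3) (λ k → + 1 /ℚ (1 + 3 * k)) ≡ 1ℚ [modℚ p ])
      × (sumTo ((p ∸ 5) / 3) (λ k → + 1 /ℚ (2 + 3 * k)) ≡ ½ *ℚ q₃ p {{prime⇒nonZero pr}} [modℚ p ]))
lemma3 p pr 5≤p =
  (λ p%3≡1 → case-one-mod-three ((p ∸ 4) / 3) (residue-decomposition p 1 p%3≡1 (ℕ.≤-trans (ℕ.n≤1+n 4) 5≤p))) ,
  (λ p%3≡2 → case-two-mod-three ((p ∸ 5) / 3) (residue-decomposition p 2 p%3≡2 5≤p))
  where open Localisation p pr
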